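{- Let $\mathbf A$ be an Almost Gautama algebra and $x,y\in A$. Then $y''\lor y^*=(x'\lor x'^*)'\lor y''\lor y^*$.
   Context: An Almost Gautama algebra is an algebra $\mathbf A=\langle A,\lor,\land,{}^*,{}',0,1\rangle$ such that: (a) $\langle A,\lor,\land,{}^*,0,1\rangle$ is a Stone algebra (a bounded distributive lattice with pseudocomplement ${}^*$ satisfying $x^*\lor x^{**}\approx 1$); (b) $\langle A,\lor,\land,{}',0,1\rangle$ is a dually quasi-De Morgan algebra: a bounded distributive lattice with $0'\approx1$, $1'\approx0$, $(x\land y)'\approx x'\lor y'$, $(x\lor y)''\approx x''\lor y''$, $x''\le x$; (c) $x\land x'{}^*{}'\le y\lor y^*$; (d) $x^*{}''\approx x^*$; (e) $(x\land x'^*)'^*\approx x\land x'^*$. Here $x'^*$ means $(x')^*$ etc. -}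

module Defs where

open import Level using (Level; suc; _⊔_)
open import Relation.Binary.PropositionalEquality using (_≡_)

record AlmostGautama (a : Level) : Set (suc a) where
  infixr 6 _∨_
  infixr 7 _∧_
  infix 9 _* _′
  field
    Carrier : Set a
    _∨_ _∧_ : Carrier → Carrier → Carrier
    _* _′   : Carrier → Carrier
    𝟘 𝟙     : Carrier

  infix 4 _≤_
  _≤_ : Carrier → Carrier → Set a
  x ≤ y = x ∧ y ≡ x

  field
    ∨-assoc : ∀ x y z → (x ∨ y) ∨ z ≡ x ∨ (y ∨ z)
    ∧-assoc : ∀ x y z → (x ∧ y) ∧ z ≡ x ∧ (y ∧ z)
    ∨-comm  : ∀ x y → x ∨ y ≡ y ∨ x
    ∧-comm  : ∀ x y → x ∧ y ≡ y ∧ x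
    ∨-absorbs-∧ : ∀ x y → x ∨ (x ∧ y) ≡ x
    ∧-absorbs-∨ : ∀ x y → x ∧ (x ∨ y) ≡ x
    ∧-distribˡ-∨ : ∀ x y z → x ∧ (y ∨ z) ≡ (x ∧ y) ∨ (x ∧ z)
    ∨-identityʳ : ∀ x → x ∨ 𝟘 ≡ x
    ∧-identityʳ : ∀ x → x ∧ 𝟙 ≡ x
    pc₁ : ∀ x → x ∧ x * ≡ 𝟘
    pc₂ : ∀ x y → x ∧ y ≡ 𝟘 → y ≤ x *
    stone : ∀ x → x * ∨ x * * ≡ 𝟙
    𝟘′ : 𝟘 ′ ≡ 𝟙
    𝟙′ : 𝟙 ′ ≡ 𝟘
    ∧′ : ∀ x y → (x ∧ y) ′ ≡ x ′ ∨ y ′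
    ∨′′ : ∀ x y → (x ∨ y) ′ ′ ≡ x ′ ′ ∨ y ′ ′
    ′′≤ : ∀ x → x ′ ′ ≤ x
    axC : ∀ x y → x ∧ x ′ * ′ ≤ y ∨ y *
    axD : ∀ x → x * ′ ′ ≡ x *
    axE : ∀ x → (x ∧ x ′ *) ′ * ≡ x ∧ x ′ *

-- Put v = x′ ∨ x′*. Dualising the join gives v′ ≤ x′′ ∧ x′*′ ≤ x ∧ x′*′, so axiom (c)
-- yields v′ ≤ y ∨ y*. Since v′′ ≤ v, also v′ ≤ v′′′, and applying the monotone map
-- ′′ to the previous bound gives v′′′ ≤ (y ∨ y*)′′ = y′′ ∨ y*′′ = y′′ ∨ y* by (d).
-- Hence v′ ≤ y′′ ∨ y*, which is the claimed absorption.
module Submission where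

open import Defs
open import Level using (Level)
open import Relation.Binary.PropositionalEquality
  using (_≡_; sym; trans; cong; module ≡-Reasoning)

module AlmostGautamaProperties {a : Level} (A : AlmostGautama a) where
  open AlmostGautama A
  open ≡-Reasoning

  ∧-idem : ∀ x → x ∧ x ≡ x
  ∧-idem x = begin
    x ∧ x             ≡⟨ cong (x ∧_) (sym (∨-absorbs-∧ x x)) ⟩
    x ∧ (x ∨ x ∧ x)   ≡⟨ ∧-absorbs-∨ x (x ∧ x) ⟩
    x                 ∎

  ≤-refl : ∀ x → x ≤ x
  ≤-refl = ∧-idem

  ≤-trans : ∀ {x y z} → x ≤ y → y ≤ z → x ≤ z
  ≤-trans {x} {y} {z} x≤y y≤z = begin
    x ∧ z         ≡⟨ cong (_∧ z) (sym x≤y) ⟩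
    (x ∧ y) ∧ z   ≡⟨ ∧-assoc x y z ⟩
    x ∧ (y ∧ z)   ≡⟨ cong (x ∧_) y≤z ⟩
    x ∧ y         ≡⟨ x≤y ⟩
    x             ∎

  x≤x∨y : ∀ x y → x ≤ x ∨ y
  x≤x∨y = ∧-absorbs-∨

  y≤x∨y : ∀ x y → y ≤ x ∨ y
  y≤x∨y x y = trans (cong (y ∧_) (∨-comm x y)) (∧-absorbs-∨ y x)

  x∧y≤x : ∀ x y → x ∧ y ≤ x
  x∧y≤x x y = begin
    (x ∧ y) ∧ x   ≡⟨ ∧-comm (x ∧ y) x ⟩
    x ∧ (x ∧ y)   ≡⟨ sym (∧-assoc x x y) ⟩
    (x ∧ x) ∧ y   ≡⟨ cong (_∧ y) (∧-idem x) ⟩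
    x ∧ y         ∎

  x∧y≤y : ∀ x y → x ∧ y ≤ y
  x∧y≤y x y = trans (∧-assoc x y y) (cong (x ∧_) (∧-idem y))

  ∧-greatest : ∀ {x y z} → x ≤ y → x ≤ z → x ≤ y ∧ z
  ∧-greatest {x} {y} {z} x≤y x≤z =
    trans (sym (∧-assoc x y z)) (trans (cong (_∧ z) x≤y) x≤z)

  ∧-monotone : ∀ {x y u v} → x ≤ y → u ≤ v → x ∧ u ≤ y ∧ v
  ∧-monotone {x} {y} {u} {v} x≤y u≤v = ∧-greatest
    (≤-trans (x∧y≤x x u) x≤y)
    (≤-trans (x∧y≤y x u) u≤v)

  ≤⇒≡∨ : ∀ {x y} → x ≤ y → y ≡ x ∨ y
  ≤⇒≡∨ {x} {y} x≤y = sym (begin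
    x ∨ y         ≡⟨ cong (_∨ y) (sym x≤y) ⟩
    x ∧ y ∨ y     ≡⟨ ∨-comm (x ∧ y) y ⟩
    y ∨ x ∧ y     ≡⟨ cong (y ∨_) (∧-comm x y) ⟩
    y ∨ y ∧ x     ≡⟨ ∨-absorbs-∧ y x ⟩
    y             ∎)

  ′-antitone : ∀ {x y} → x ≤ y → y ′ ≤ x ′
  ′-antitone {x} {y} x≤y = begin
    y ′ ∧ x ′           ≡⟨ cong (λ z → y ′ ∧ z ′) (sym x≤y) ⟩
    y ′ ∧ (x ∧ y) ′     ≡⟨ cong (y ′ ∧_) (∧′ x y) ⟩
    y ′ ∧ (x ′ ∨ y ′)   ≡⟨ cong (y ′ ∧_) (∨-comm (x ′) (y ′)) ⟩
    y ′ ∧ (y ′ ∨ x ′)   ≡⟨ ∧-absorbs-∨ (y ′) (x ′) ⟩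
    y ′                 ∎

  ′′-monotone : ∀ {x y} → x ≤ y → x ′ ′ ≤ y ′ ′
  ′′-monotone x≤y = ′-antitone (′-antitone x≤y)

  x′≤x′′′ : ∀ x → x ′ ≤ x ′ ′ ′
  x′≤x′′′ x = ′-antitone (′′≤ x)

  ∨′≤∧′ : ∀ x y → (x ∨ y) ′ ≤ x ′ ∧ y ′
  ∨′≤∧′ x y = ∧-greatest (′-antitone (x≤x∨y x y)) (′-antitone (y≤x∨y x y))

  [x∨x*]′′≡x′′∨x* : ∀ x → (x ∨ x *) ′ ′ ≡ x ′ ′ ∨ x *
  [x∨x*]′′≡x′′∨x* x = trans (∨′′ x (x *)) (cong (x ′ ′ ∨_) (axD x))

  [x′∨x′*]′≤y∨y* : ∀ x y → (x ′ ∨ x ′ *) ′ ≤ y ∨ y *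
  [x′∨x′*]′≤y∨y* x y = ≤-trans (∨′≤∧′ (x ′) (x ′ *))
    (≤-trans (∧-monotone (′′≤ x) (≤-refl (x ′ * ′))) (axC x y))

  [x′∨x′*]′≤y′′∨y* : ∀ x y → (x ′ ∨ x ′ *) ′ ≤ y ′ ′ ∨ y *
  [x′∨x′*]′≤y′′∨y* x y = ≤-trans (x′≤x′′′ (x ′ ∨ x ′ *))
    (trans (cong (v ′ ′ ′ ∧_) (sym ([x∨x*]′′≡x′′∨x* y)))
           (′′-monotone ([x′∨x′*]′≤y∨y* x y)))
    where
    v = x ′ ∨ x ′ *

lemma3p17 : {a : Level} (A : AlmostGautama a) → let open AlmostGautama A in
    ∀ x y → y ′ ′ ∨ y * ≡ (x ′ ∨ x ′ *) ′ ∨ y ′ ′ ∨ y *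
lemma3p17 A x y = ≤⇒≡∨ ([x′∨x′*]′≤y′′∨y* x y)
  where open AlmostGautamaProperties A
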